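{- Let $\mathbf I=(i_0,i_1,\ldots)$ be the frame of some Dyck path. Define its left progenitor as follows: if $i_0\neq 2$ it is $\mathbf I$ itself; if $i_0=i_1=\cdots=i_{t-1}=2$ and $i_t\neq 2$, it is $(i_t,i_{t+1},\ldots)$. Then the number of Dyck paths with frame $\mathbf I$ equals the number of Dyck paths with frame equal to the left progenitor of $\mathbf I$.
   Context: A Dyck path of length $2n$ is a lattice path from $(0,0)$ to $(2n,0)$ with steps $(1,1)$, $(1,-1)$ never going below the $x$-axis. The frame of a Dyck path is the eventually zero sequence $(i_0,i_1,\ldots)$ where $i_k$ is the number of vertices (including endpoints) at height $k$. -}

module Defs where

open import Data.Nat using (ℕ; zero; suc; _∸_; _⊔_; _≟_)
open import Data.List using (List; []; _∷_; _++_; map; length; filter; foldr; upTo; dropWhile; [_])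
open import Data.Nat.ListAction using (sum)
open import Data.List.Properties using (≡-dec)
open import Data.Empty using (⊥)
open import Data.Unit using (⊤)
open import Data.Product using (_×_)
open import Relation.Nullary using (Dec; yes; no)
open import Relation.Nullary.Decidable using (_×-dec_)
open import Relation.Binary.PropositionalEquality using (_≡_)

-- Steps of a lattice path: U = (1,1), D = (1,-1).
data Step : Set where
  U D : Step

-- height after one step (D from height 0 is irrelevant for Dyck paths)
next : ℕ → Step → ℕ
next h U = suc h
next h D = h ∸ 1

DyckFrom : ℕ → List Step → Set
DyckFrom h       (U ∷ s)  = DyckFrom (suc h) s
DyckFrom zero    (D ∷ s)  = ⊥
DyckFrom (suc h) (D ∷ s)  = DyckFrom h s
DyckFrom zero    []       = ⊤
DyckFrom (suc h) []       = ⊥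

IsDyck : List Step → Set
IsDyck = DyckFrom 0

dyckFrom? : ∀ h s → Dec (DyckFrom h s)
dyckFrom? h       (U ∷ s) = dyckFrom? (suc h) s
dyckFrom? zero    (D ∷ s) = no (λ ())
dyckFrom? (suc h) (D ∷ s) = dyckFrom? h s
dyckFrom? zero    []      = yes _
dyckFrom? (suc h) []      = no (λ ())

isDyck? : ∀ s → Dec (IsDyck s)
isDyck? = dyckFrom? 0

heightsFrom : ℕ → List Step → List ℕ
heightsFrom h []       = h ∷ []
heightsFrom h (s ∷ ss) = h ∷ heightsFrom (next h s) ss

heights : List Step → List ℕ
heights = heightsFrom 0

verticesAt : List Step → ℕ → ℕ
verticesAt p k = length (filter (λ h → h ≟ k) (heights p))

maxHeight : List Step → ℕ
maxHeight p = foldr _⊔_ 0 (heights p)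

-- The frame (i_0, i_1, ...) of a path, as the finite list (i_0, ..., i_H)
-- where H is the maximal height; all further entries are 0 and are omitted.
-- Eventually-zero sequences are represented by lists without trailing zeros.
frame : List Step → List ℕ
frame p = map (verticesAt p) (upTo (suc (maxHeight p)))

allPaths : ℕ → List (List Step)
allPaths zero    = [ [] ]
allPaths (suc n) = map (U ∷_) (allPaths n) ++ map (D ∷_) (allPaths n)

-- Number of Dyck paths with frame I.  A path with frame I has
-- i_0 + i_1 + ... = (number of vertices) = (length + 1) vertices, so only
-- paths of length (sum I - 1) can have frame I.
numDyckWithFrame : List ℕ → ℕ
numDyckWithFrame I =
  length (filter (λ p → isDyck? p ×-dec ≡-dec _≟_ (frame p) I) (allPaths (sum I ∸ 1)))

IsDyckFrame : List ℕ → Set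
IsDyckFrame I = Data.Product.Σ (List Step) (λ p → IsDyck p × frame p ≡ I)

leftProgenitor : List ℕ → List ℕ
leftProgenitor = dropWhile (λ i → i ≟ 2)

module Submission where

-- Write wrap x = U x D.  For every J, wrapping is a bijection from
-- Dyck paths with frame J onto Dyck paths with frame 2 ∷ J:
--   * the heights of wrap x are 0, (heights of x shifted up by one), 0, so
--     its frame is 2 ∷ frame x;
--   * conversely, a Dyck path whose frame starts with 2 visits height 0 only
--     at its two endpoints, hence it is U x D with x itself a Dyck path.
-- Consequently numDyckWithFrame (2 ∷ J) ≡ numDyckWithFrame J, and stripping
-- the leading 2's one at a time proves the theorem.  (The argument never uses
-- that I is a Dyck frame, so the equality holds for every list I.)

open import Defs
open import Data.Nat using (ℕ; zero; suc; _+_; _∸_; _≤_; _⊔_; _≟_; s≤s; z≤n)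
open import Data.Nat.Properties using (+-comm; +-commutativeSemigroup; ⊔-identityʳ; 1+n≢0; ≤-refl; ≤-trans; n≤1+n; <⇒≱; ≤-reflexive)
open import Data.Nat.ListAction using (sum)
open import Algebra.Properties.CommutativeSemigroup +-commutativeSemigroup using (interchange)
open import Data.List using (List; []; _∷_; _++_; [_]; map; filter; length; foldr; applyUpTo; upTo)
open import Data.List.Properties using (length-++; filter-++; filter-none; filter-reject; filter-≐; map-upTo; map-cong; ∷-injectiveʳ; ≡-dec)
open import Data.List.Relation.Unary.All using (universal)
open import Data.Product using (_×_; _,_; proj₁)
open import Data.Sum using (_⊎_; inj₁; inj₂)
open import Data.Empty using (⊥-elim)
open import Data.Unit using (tt)
open import Data.Bool using (true; false)
open import Function using (_∘_)
open import Level using (0ℓ)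
open import Relation.Nullary using (¬_; does)
open import Relation.Nullary.Decidable using (_×-dec_)
open import Relation.Unary using (Pred; Decidable; _≐_)
open import Relation.Binary.PropositionalEquality
  using (_≡_; refl; sym; trans; cong; cong₂; module ≡-Reasoning)
open ≡-Reasoning

module _ {A : Set} where

  count : {P : Pred A 0ℓ} → Decidable P → List A → ℕ
  count P? xs = length (filter P? xs)

  count-++ : {P : Pred A 0ℓ} (P? : Decidable P) (xs ys : List A) →
             count P? (xs ++ ys) ≡ count P? xs + count P? ys
  count-++ P? xs ys = trans (cong length (filter-++ P? xs ys)) (length-++ (filter P? xs))

  count-≐ : {P Q : Pred A 0ℓ} (P? : Decidable P) (Q? : Decidable Q) →
            P ≐ Q → (xs : List A) → count P? xs ≡ count Q? xs
  count-≐ P? Q? P≐Q xs = cong length (filter-≐ P? Q? P≐Q xs)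

  count-none : {P : Pred A 0ℓ} (P? : Decidable P) →
               (∀ x → ¬ P x) → (xs : List A) → count P? xs ≡ 0
  count-none P? ¬P xs = cong length (filter-none P? (universal ¬P xs))

count-map : {A B : Set} {P : Pred B 0ℓ} (P? : Decidable P) (f : A → B) (xs : List A) →
            count P? (map f xs) ≡ count (λ x → P? (f x)) xs
count-map P? f []       = refl
count-map P? f (x ∷ xs) with does (P? (f x))
... | true  = cong suc (count-map P? f xs)
... | false = count-map P? f xs

countPaths : {P : Pred (List Step) 0ℓ} → Decidable P → ℕ → ℕ
countPaths P? n = count P? (allPaths n)

countPaths-first : {P : Pred (List Step) 0ℓ} (P? : Decidable P) (n : ℕ) →
  countPaths P? (suc n) ≡ countPaths (λ x → P? (U ∷ x)) n + countPaths (λ x → P? (D ∷ x)) n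
countPaths-first P? n =
  trans (count-++ P? (map (U ∷_) (allPaths n)) (map (D ∷_) (allPaths n)))
        (cong₂ _+_ (count-map P? (U ∷_) (allPaths n)) (count-map P? (D ∷_) (allPaths n)))

countPaths-last : {P : Pred (List Step) 0ℓ} (P? : Decidable P) (n : ℕ) →
  countPaths P? (suc n) ≡ countPaths (λ x → P? (x ++ [ U ])) n + countPaths (λ x → P? (x ++ [ D ])) n
countPaths-last P? zero = trans (countPaths-first P? zero) (cong₂ _+_ (oneStep U) (oneStep D))
  where
  oneStep : ∀ s → countPaths (λ x → P? (s ∷ x)) 0 ≡ countPaths (λ x → P? (x ++ [ s ])) 0
  oneStep s = trans (sym (count-map P? (s ∷_) [ [] ])) (count-map P? (_++ [ s ]) [ [] ])
countPaths-last P? (suc n) = begin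
    countPaths P? (suc (suc n))
  ≡⟨ countPaths-first P? (suc n) ⟩
    countPaths (λ x → P? (U ∷ x)) (suc n) + countPaths (λ x → P? (D ∷ x)) (suc n)
  ≡⟨ cong₂ _+_ (countPaths-last (λ x → P? (U ∷ x)) n) (countPaths-last (λ x → P? (D ∷ x)) n) ⟩
    (uu + ud) + (du + dd)
  ≡⟨ interchange uu ud du dd ⟩
    (uu + du) + (ud + dd)
  ≡⟨ sym (cong₂ _+_ (countPaths-first (λ x → P? (x ++ [ U ])) n)
                    (countPaths-first (λ x → P? (x ++ [ D ])) n)) ⟩
    countPaths (λ x → P? (x ++ [ U ])) (suc n) + countPaths (λ x → P? (x ++ [ D ])) (suc n) ∎
  where
  uu ud du dd : ℕ
  uu = countPaths (λ x → P? (U ∷ x ++ [ U ])) n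
  ud = countPaths (λ x → P? (U ∷ x ++ [ D ])) n
  du = countPaths (λ x → P? (D ∷ x ++ [ U ])) n
  dd = countPaths (λ x → P? (D ∷ x ++ [ D ])) n

wrap : List Step → List Step
wrap x = U ∷ (x ++ [ D ])

countPaths-wrapped : {P : Pred (List Step) 0ℓ} (P? : Decidable P) →
  (∀ x → ¬ P (D ∷ x)) → (∀ x → ¬ P (U ∷ x ++ [ U ])) →
  (n : ℕ) → countPaths P? (suc (suc n)) ≡ countPaths (λ x → P? (wrap x)) n
countPaths-wrapped P? ¬startD ¬endU n = begin
    countPaths P? (suc (suc n))
  ≡⟨ countPaths-first P? (suc n) ⟩
    countPaths (λ x → P? (U ∷ x)) (suc n) + countPaths (λ x → P? (D ∷ x)) (suc n)
  ≡⟨ cong₂ _+_ (countPaths-last (λ x → P? (U ∷ x)) n)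
               (count-none (λ x → P? (D ∷ x)) ¬startD (allPaths (suc n))) ⟩
    (countPaths (λ x → P? (U ∷ x ++ [ U ])) n + countPaths (λ x → P? (wrap x)) n) + 0
  ≡⟨ cong (λ z → (z + countPaths (λ x → P? (wrap x)) n) + 0)
          (count-none (λ x → P? (U ∷ x ++ [ U ])) ¬endU (allPaths n)) ⟩
    countPaths (λ x → P? (wrap x)) n + 0
  ≡⟨ +-comm _ 0 ⟩
    countPaths (λ x → P? (wrap x)) n ∎

occurrences : ℕ → List ℕ → ℕ
occurrences k l = length (filter (λ h → h ≟ k) l)

occurrences-∷ : ∀ k a l → occurrences k l ≤ occurrences k (a ∷ l)
occurrences-∷ k a l with does (a ≟ k)
... | true  = n≤1+n _
... | false = ≤-refl

occurrences-lift : ∀ k l → occurrences (suc k) (map suc l ++ [ 0 ]) ≡ occurrences k l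
occurrences-lift k []      = refl
occurrences-lift k (a ∷ l) with does (a ≟ k)
... | true  = cong suc (occurrences-lift k l)
... | false = occurrences-lift k l

occurrences-zero-lift : ∀ l → occurrences 0 (map suc l ++ [ 0 ]) ≡ 1
occurrences-zero-lift []      = refl
occurrences-zero-lift (a ∷ l) = occurrences-zero-lift l

maximum-lift : ∀ a t → foldr _⊔_ 0 (map suc (a ∷ t) ++ [ 0 ]) ≡ suc (foldr _⊔_ 0 (a ∷ t))
maximum-lift a []      = cong suc (sym (⊔-identityʳ a))
maximum-lift a (b ∷ t) = cong (suc a ⊔_) (maximum-lift b t)

dyck-lift : ∀ h x → DyckFrom h x → DyckFrom (suc h) (x ++ [ D ])
dyck-lift zero    []      _ = tt
dyck-lift h       (U ∷ s) d = dyck-lift (suc h) s d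
dyck-lift (suc h) (D ∷ s) d = dyck-lift h s d

heights-lift : ∀ h x → DyckFrom h x →
  heightsFrom (suc h) (x ++ [ D ]) ≡ map suc (heightsFrom h x) ++ [ 0 ]
heights-lift zero    []      _ = refl
heights-lift h       (U ∷ s) d = cong (suc h ∷_) (heights-lift (suc h) s d)
heights-lift (suc h) (D ∷ s) d = cong (suc (suc h) ∷_) (heights-lift h s d)

dyck-visits-zero : ∀ h l → DyckFrom h l → 1 ≤ occurrences 0 (heightsFrom h l)
dyck-visits-zero zero    []      _ = s≤s z≤n
dyck-visits-zero h       (U ∷ s) d =
  ≤-trans (dyck-visits-zero (suc h) s d) (occurrences-∷ 0 h (heightsFrom (suc h) s))
dyck-visits-zero (suc h) (D ∷ s) d =
  ≤-trans (dyck-visits-zero h s d) (occurrences-∷ 0 (suc h) (heightsFrom h s))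

dyck-unlift : ∀ h x → DyckFrom (suc h) (x ++ [ D ]) →
  DyckFrom h x ⊎ 2 ≤ occurrences 0 (heightsFrom (suc h) (x ++ [ D ]))
dyck-unlift h       []          d = inj₁ d
dyck-unlift h       (U ∷ s)     d = dyck-unlift (suc h) s d
dyck-unlift (suc h) (D ∷ s)     d = dyck-unlift h s d
dyck-unlift zero    (D ∷ U ∷ s) d = inj₂ (s≤s (dyck-visits-zero 1 (s ++ [ D ]) d))

dyck-not-ending-U : ∀ h x → ¬ DyckFrom h (x ++ [ U ])
dyck-not-ending-U h       (U ∷ s) d = dyck-not-ending-U (suc h) s d
dyck-not-ending-U (suc h) (D ∷ s) d = dyck-not-ending-U h s d

-- Heights of wrap x are 0, heights of x raised by one, 0: so height 0 is
-- visited twice, height k + 1 as often as height k in x, and the maximal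
-- height grows by one.
frame-wrap : ∀ x → IsDyck x → frame (wrap x) ≡ 2 ∷ frame x
frame-wrap x d = begin
    map vw (upTo (suc (maxHeight (wrap x))))
  ≡⟨ cong (λ m → map vw (upTo (suc m))) maxHeight-wrap ⟩
    map vw (upTo (suc (suc (maxHeight x))))
  ≡⟨ map-upTo vw (suc (suc (maxHeight x))) ⟩
    vw 0 ∷ applyUpTo (vw ∘ suc) (suc (maxHeight x))
  ≡⟨ cong (vw 0 ∷_) (sym (map-upTo (vw ∘ suc) (suc (maxHeight x)))) ⟩
    vw 0 ∷ map (vw ∘ suc) (upTo (suc (maxHeight x)))
  ≡⟨ cong₂ _∷_ verticesAt-wrap-zero (map-cong verticesAt-wrap-suc (upTo (suc (maxHeight x)))) ⟩
    2 ∷ frame x ∎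
  where
  vw : ℕ → ℕ
  vw = verticesAt (wrap x)
  heights-wrap : heights (wrap x) ≡ 0 ∷ map suc (heights x) ++ [ 0 ]
  heights-wrap = cong (0 ∷_) (heights-lift 0 x d)
  -- heights x is nonempty, so maximum-lift applies
  maximum-heights-lift : ∀ y → foldr _⊔_ 0 (map suc (heights y) ++ [ 0 ]) ≡ suc (maxHeight y)
  maximum-heights-lift []      = maximum-lift 0 []
  maximum-heights-lift (s ∷ y) = maximum-lift 0 (heightsFrom (next 0 s) y)
  maxHeight-wrap : maxHeight (wrap x) ≡ suc (maxHeight x)
  maxHeight-wrap = trans (cong (foldr _⊔_ 0) heights-wrap) (maximum-heights-lift x)
  verticesAt-wrap-zero : vw 0 ≡ 2
  verticesAt-wrap-zero =
    trans (cong (occurrences 0) heights-wrap) (cong suc (occurrences-zero-lift (heights x)))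
  verticesAt-wrap-suc : ∀ k → vw (suc k) ≡ verticesAt x k
  verticesAt-wrap-suc k =
    trans (cong (occurrences (suc k)) heights-wrap) (occurrences-lift k (heights x))

HasFrame : List ℕ → Pred (List Step) 0ℓ
HasFrame I p = IsDyck p × frame p ≡ I

-- numDyckWithFrame I is, by definition, countPaths (hasFrame? I) (sum I ∸ 1).
hasFrame? : (I : List ℕ) → Decidable (HasFrame I)
hasFrame? I p = isDyck? p ×-dec ≡-dec _≟_ (frame p) I

wrap-preserves : ∀ {J} x → HasFrame J x → HasFrame (2 ∷ J) (wrap x)
wrap-preserves x (d , f) = dyck-lift 0 x d , trans (frame-wrap x d) (cong (2 ∷_) f)

-- A wrapped Dyck path with frame 2 ∷ J touches 0 only at its endpoints, so
-- the inner path is a Dyck path, and then its frame is J.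
wrap-reflects : ∀ {J} x → HasFrame (2 ∷ J) (wrap x) → HasFrame J x
wrap-reflects x (d , f) with dyck-unlift 0 x d
... | inj₁ dx = dx , ∷-injectiveʳ (trans (sym (frame-wrap x dx)) f)
-- otherwise height 0 is visited at least three times, but the first frame
-- entry is 2
... | inj₂ twoZeros = ⊥-elim (<⇒≱ (s≤s twoZeros) (≤-reflexive (cong head f)))
  where
  head : List ℕ → ℕ
  head []      = 0
  head (a ∷ _) = a

wrap-≐ : ∀ J → (λ x → HasFrame (2 ∷ J) (wrap x)) ≐ HasFrame J
wrap-≐ J = (λ {x} → wrap-reflects x) , (λ {x} → wrap-preserves x)

numDyckWithFrame-2∷ : ∀ J → numDyckWithFrame (2 ∷ J) ≡ numDyckWithFrame J
numDyckWithFrame-2∷ J = byLength (sum J) refl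
  where
  byLength : ∀ m → sum J ≡ m →
    countPaths (hasFrame? (2 ∷ J)) (suc m) ≡ countPaths (hasFrame? J) (m ∸ 1)
  -- No path of length 1 is Dyck, and the empty path has frame [ 1 ] ≠ J.
  byLength zero    sumJ≡0 =
    sym (cong length (filter-reject (hasFrame? J) {[]} {[]} emptyPathExcluded))
    where
    emptyPathExcluded : ¬ HasFrame J []
    emptyPathExcluded (_ , f) = 1+n≢0 (trans (cong sum f) sumJ≡0)
  byLength (suc n) _      = begin
      countPaths (hasFrame? (2 ∷ J)) (suc (suc n))
    ≡⟨ countPaths-wrapped (hasFrame? (2 ∷ J)) (λ _ → proj₁)
                          (λ x → dyck-not-ending-U 1 x ∘ proj₁) n ⟩
      countPaths (λ x → hasFrame? (2 ∷ J) (wrap x)) n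
    ≡⟨ count-≐ (λ x → hasFrame? (2 ∷ J) (wrap x)) (hasFrame? J) (wrap-≐ J) (allPaths n) ⟩
      countPaths (hasFrame? J) n ∎

-- Strip the leading 2's one at a time.
numDyckWithFrame-leftProgenitor : ∀ I → numDyckWithFrame I ≡ numDyckWithFrame (leftProgenitor I)
numDyckWithFrame-leftProgenitor []                      = refl
numDyckWithFrame-leftProgenitor (0 ∷ I)                 = refl
numDyckWithFrame-leftProgenitor (1 ∷ I)                 = refl
numDyckWithFrame-leftProgenitor (2 ∷ I)                 =
  trans (numDyckWithFrame-2∷ I) (numDyckWithFrame-leftProgenitor I)
numDyckWithFrame-leftProgenitor (suc (suc (suc k)) ∷ I) = refl

mainTheorem12 : (I : List ℕ) → IsDyckFrame I →
    numDyckWithFrame I ≡ numDyckWithFrame (leftProgenitor I)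
mainTheorem12 I _ = numDyckWithFrame-leftProgenitor I
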